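{- Let $X$ be a finite set, $\mathcal{P}$ a partition of $X$ and $\mathfrak{S}$ a tree-like split system on $X$. Then $\mathcal{P}$ and $\mathfrak{S}$ are compatible if and only if there is a subset $\mathfrak{H}\subseteq\mathfrak{S}$ such that $\mathcal{P}$ is the common refinement of $\mathfrak{H}$. In this case, $\mathcal{P}=\mathcal{F}(\overline{T},H)$ for the unrooted tree $\overline{T}$ with $\mathfrak{S}(\overline{T})=\mathfrak{S}$ and $H=\{e\in E(\overline{T}) : \mathcal{S}_e\in\mathfrak{H}\}$.
   Context: An unrooted phylogenetic tree on $X$ is an unrooted tree with leaf set $X$ in which every non-leaf vertex has degree at least three (throughout, such trees have at least three leaves). A split $A_1|A_2$ of $X$ is a partition of $X$ into two nonempty sets. For an edge $e$ of $\overline{T}$, $\mathcal{S}_e$ is the split formed by the leaf sets of the two components of $\overline{T}-e$; $\mathfrak{S}(\overline{T})=\{\mathcal{S}_e:e\in E(\overline{T})\}$. A split system is tree-like if it contains all splits $\{x\}|(X\setminus\{x\})$ and for any two of its splits $A_1|A_2,B_1|B_2$ at least one of $A_1\cap B_1,A_1\cap B_2,A_2\cap B_1,A_2\cap B_2$ is empty; then there is a unique (up to isomorphism) unrooted phylogenetic tree $\overline{T}$ with $\mathfrak{S}(\overline{T})=\mathfrak{S}$. For $H\subseteq E(\overline{T})$, $\mathcal{F}(\overline{T},H)$ is the partition of $X$ into leaf sets of the connected components of $\overline{T}-H$. $\mathcal{P}$ is compatible with $\overline{T}$ if $\mathcal{P}=\mathcal{F}(\overline{T},H)$ for some $H$,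 and compatible with a tree-like split system $\mathfrak{S}$ if compatible with the tree $\overline{T}$ with $\mathfrak{S}(\overline{T})=\mathfrak{S}$. The common refinement of a set $\mathfrak{H}$ of partitions (splits being partitions) is the partition whose classes are the nonempty sets $\bigcap\{B : B\in\mathcal{Q}\in\mathfrak{H},\ x\in B\}$, $x\in X$. -}

module Defs where

open import Data.Nat using (ℕ; _+_; _≤_)
open import Data.Fin using (Fin; _≟_)
open import Data.List using (map; allFin)
open import Data.Nat.ListAction using (sum)
open import Data.Product using (Σ; ∃; ∃-syntax; _×_; _,_; proj₁; proj₂)
open import Data.Sum using (_⊎_)
open import Data.Empty using (⊥)
open import Data.Unit using (⊤)
open import Data.Bool using (if_then_else_)
open import Relation.Nullary using (¬_; does)
open import Relation.Binary.PropositionalEquality using (_≡_; _≢_)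
open import Function using (Injective; _⇔_)

Subset : ℕ → Set₁
Subset n = Fin n → Set

_≐_ : ∀ {n} → Subset n → Subset n → Set
A ≐ B = ∀ x → A x ⇔ B x

Nonempty : ∀ {n} → Subset n → Set
Nonempty A = ∃ λ x → A x

Empty : ∀ {n} → Subset n → Set
Empty A = ∀ x → ¬ A x

_∩_ : ∀ {n} → Subset n → Subset n → Subset n
(A ∩ B) x = A x × B x

record Partition (n : ℕ) : Set₁ where
  field
    size     : ℕ
    block    : Fin size → Subset n
    nonempty : ∀ i → Nonempty (block i)
    covers   : ∀ x → ∃ λ i → block i x
    disjoint : ∀ i j x → block i x → block j x → i ≡ j

open Partition public

BlocksAre : ∀ {n} → Partition n → (Subset n → Set) → Set₁
BlocksAre P C =
  (∀ i → ∃ λ B → C B × (block P i ≐ B)) ×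
  (∀ B → C B → ∃ λ i → block P i ≐ B)

record Split (n : ℕ) : Set₁ where
  field
    A₁ A₂     : Subset n
    ne₁       : Nonempty A₁
    ne₂       : Nonempty A₂
    cover     : ∀ x → A₁ x ⊎ A₂ x
    disj      : ∀ x → A₁ x → A₂ x → ⊥

open Split public

-- A split A₁|A₂ equals the unordered pair {L , R} of subsets.
_≐ₛ_,_ : ∀ {n} → Split n → Subset n → Subset n → Set
σ ≐ₛ L , R = ((A₁ σ ≐ L) × (A₂ σ ≐ R)) ⊎ ((A₁ σ ≐ R) × (A₂ σ ≐ L))

_≐S_ : ∀ {n} → Split n → Split n → Set
σ ≐S τ = σ ≐ₛ A₁ τ , A₂ τ

-- A (finite) split system: a family of splits indexed by Fin s
-- (the split system is the image of the family).
record SplitSystem (n : ℕ) : Set₁ where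
  field
    card  : ℕ
    split : Fin card → Split n

open SplitSystem public

SubSystem : ∀ {n} → SplitSystem n → Set₁
SubSystem 𝔖 = Fin (card 𝔖) → Set

TreeLike : ∀ {n} → SplitSystem n → Set
TreeLike {n} 𝔖 =
  (∀ x → ∃ λ j → split 𝔖 j ≐ₛ (λ y → y ≡ x) , (λ y → y ≢ x)) ×
  (∀ i j → let σ = split 𝔖 i ; τ = split 𝔖 j in
      Empty (A₁ σ ∩ A₁ τ) ⊎ Empty (A₁ σ ∩ A₂ τ) ⊎
      Empty (A₂ σ ∩ A₁ τ) ⊎ Empty (A₂ σ ∩ A₂ τ))

data Reach {m k : ℕ} (ends : Fin k → Fin m × Fin m) (allowed : Fin k → Set)
           : Fin m → Fin m → Set where
  here  : ∀ {u} → Reach ends allowed u u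
  fwd   : ∀ {u v} e → allowed e → proj₁ (ends e) ≡ u →
          Reach ends allowed (proj₂ (ends e)) v → Reach ends allowed u v
  bwd   : ∀ {u v} e → allowed e → proj₂ (ends e) ≡ u →
          Reach ends allowed (proj₁ (ends e)) v → Reach ends allowed u v

degree : ∀ {m k} → (Fin k → Fin m × Fin m) → Fin m → ℕ
degree {k = k} ends v =
  sum (map (λ e → (if does (v ≟ proj₁ (ends e)) then 1 else 0)
                + (if does (v ≟ proj₂ (ends e)) then 1 else 0)) (allFin k))

-- A tree: connected graph in which every edge is a bridge (i.e. a
-- minimally connected graph; this excludes loops, parallel edges, cycles).
record UTree (n : ℕ) : Set where
  field
    nV nE     : ℕ
    ends      : Fin nE → Fin nV × Fin nV
    connected : ∀ u v → Reach ends (λ _ → ⊤) u v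
    bridge    : ∀ e → ¬ Reach ends (λ f → f ≢ e) (proj₁ (ends e)) (proj₂ (ends e))
    leaf      : Fin n → Fin nV
    leaf-inj  : Injective _≡_ _≡_ leaf
    leaves    : ∀ v → (degree ends v ≡ 1) ⇔ (∃ λ x → leaf x ≡ v)
    internal  : ∀ v → ¬ (∃ λ x → leaf x ≡ v) → 3 ≤ degree ends v

open UTree public

compLeaves : ∀ {n} (T : UTree n) → (Fin (nE T) → Set) → Fin (nV T) → Subset n
compLeaves T H v x = Reach (ends T) (λ e → ¬ H e) v (leaf T x)

IsForestPartition : ∀ {n} (T : UTree n) → (Fin (nE T) → Set) → Partition n → Set₁
IsForestPartition T H P =
  BlocksAre P (λ B → Nonempty B × ∃ λ v → B ≐ compLeaves T H v)

IsEdgeSplit : ∀ {n} (T : UTree n) → Fin (nE T) → Split n → Set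
IsEdgeSplit T e σ =
  σ ≐ₛ compLeaves T (λ f → f ≡ e) (proj₁ (ends T e))
     , compLeaves T (λ f → f ≡ e) (proj₂ (ends T e))

Displays : ∀ {n} → UTree n → SplitSystem n → Set
Displays T 𝔖 =
  (∀ e → ∃ λ j → IsEdgeSplit T e (split 𝔖 j)) ×
  (∀ j → ∃ λ e → IsEdgeSplit T e (split 𝔖 j))

CompatibleTree : ∀ {n} → Partition n → UTree n → Set₁
CompatibleTree P T = ∃ λ (H : Fin (nE T) → Set) → IsForestPartition T H P

Compatible : ∀ {n} → Partition n → SplitSystem n → Set₁
Compatible P 𝔖 = ∃ λ (T : UTree _) → Displays T 𝔖 × CompatibleTree P T

-- Class of x in the common refinement of a set 𝔥 of splits:
-- intersection of all classes B of members of 𝔥 with x ∈ B.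
crClass : ∀ {n} (𝔖 : SplitSystem n) → SubSystem 𝔖 → Fin n → Subset n
crClass 𝔖 𝔥 x y = ∀ j → 𝔥 j →
  (A₁ (split 𝔖 j) x → A₁ (split 𝔖 j) y) × (A₂ (split 𝔖 j) x → A₂ (split 𝔖 j) y)

IsCommonRefinement : ∀ {n} (𝔖 : SplitSystem n) → SubSystem 𝔖 → Partition n → Set₁
IsCommonRefinement 𝔖 𝔥 P = BlocksAre P (λ B → ∃ λ x → B ≐ crClass 𝔖 𝔥 x)

edgesOf : ∀ {n} (T : UTree n) (𝔖 : SplitSystem n) → SubSystem 𝔖 → Fin (nE T) → Set
edgesOf T 𝔖 𝔥 e = ∃ λ j → 𝔥 j × IsEdgeSplit T e (split 𝔖 j)

{-# OPTIONS --safe #-}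

-- Every edge of a tree is a bridge, so two leaves are joined in T − H iff they are joined in
-- T − e for each single e ∈ H, i.e. iff no split 𝒮_e with e ∈ H separates them: the classes of
-- 𝓕(T, H) are those of the common refinement of {𝒮_e : e ∈ H}. Compatibility with 𝔖 therefore
-- only needs a tree displaying 𝔖. It is built from a root leaf r: the sides of the splits not
-- containing r form a laminar family of clusters (this is tree-likeness) that contains every
-- singleton {x} with x ≠ r and X ∖ {r}. Joining each cluster to the least cluster strictly
-- containing it, and X ∖ {r} to r, gives a tree whose leaves are r and the singletons and whose
-- edge splits are exactly the splits of 𝔖.

module Submission where

open import Defs
open import Data.Bool using (Bool; true; false; not; _xor_; if_then_else_)
import Data.Bool as Bool
open import Data.Bool.Properties using (not-¬; ¬-not; not-involutive)
open import Data.Empty using (⊥; ⊥-elim)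
open import Data.Fin using (Fin; zero; suc; _≟_)
open import Data.Fin.Properties using (any?; suc-injective)
open import Data.Fin.Subset as 𝒫 using (_∈_; _∉_; _⊆_; _⊂_; _⊃_; ⁅_⁆)
open import Data.Fin.Subset.Induction using (⊃-wellFounded)
open import Data.Fin.Subset.Properties
  using (_∈?_; _⊂?_; ⊆-refl; ⊆-antisym; ⊆-trans; ⊂-irref; x∈⁅x⁆; x∈⁅y⁆⇒x≡y)
open import Data.List using (List; []; _∷_; map; allFin; tabulate; lookup; length; deduplicate)
open import Data.List.Membership.Propositional using () renaming (_∈_ to _∈ₗ_)
open import Data.List.Membership.Propositional.Properties
  using (∈-allFin; ∈-map⁺; ∈-map⁻; ∈-deduplicate⁺; ∈-deduplicate⁻; ∈-lookup)
open import Data.List.Properties using (map-tabulate)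
import Data.List.Relation.Unary.All as All
open import Data.List.Relation.Unary.AllPairs using (AllPairs; _∷_)
open import Data.List.Relation.Unary.Any using (here; there; index)
open import Data.List.Relation.Unary.Any.Properties using (lookup-index)
open import Data.List.Relation.Unary.Unique.DecPropositional.Properties using (deduplicate-!)
open import Data.Nat using (ℕ; zero; suc; _+_; _≤_; s≤s; z≤n)
open import Data.Nat.ListAction using (sum)
open import Data.Nat.Properties using (m≤m+n; m≤n+m; +-mono-≤; ≤-trans; +-commutativeSemigroup)
open import Algebra.Properties.CommutativeSemigroup +-commutativeSemigroup using (x∙yz≈y∙xz)
open import Data.Product using (∃; ∃₂; _×_; _,_; proj₁; proj₂)
open import Data.Sum using (_⊎_; inj₁; inj₂; [_,_]; swap)
import Data.Sum as Sum
open import Data.Unit using (⊤; tt)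
import Data.Vec as Vec
open import Data.Vec.Properties using (≡-dec; lookup∘tabulate; lookup⇒[]=; []=⇒lookup)
open import Function using (_⇔_; mk⇔; Equivalence; _on_; id; _∘_)
import Function.Properties.Equivalence as ⇔
open import Induction.WellFounded using (Acc; acc)
import Relation.Binary.Construct.On as On
open import Relation.Binary.PropositionalEquality using (_≡_; _≢_; refl; sym; trans; cong; subst)
open import Relation.Nullary using (¬_; Dec; yes; no; does; contradiction)
open import Relation.Nullary.Decidable using (_×-dec_; ¬?; decidable-stable)

open Equivalence

least : ∀ {k} {P : Fin k → Set} {_≼_ : Fin k → Fin k → Set} →
  (∀ a → Dec (P a)) → (∀ {a b c} → a ≼ b → b ≼ c → a ≼ c) →
  (∀ {a b} → P a → P b → a ≼ b ⊎ b ≼ a) →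
  (∃ λ p → P p × ∀ q → P q → p ≼ q) ⊎ (∀ q → ¬ P q)
least {zero} P? ≼-trans total = inj₂ λ ()
least {suc k} P? ≼-trans total with least (λ a → P? (suc a)) ≼-trans total | P? zero
... | inj₂ none | no ¬P₀ = inj₂ λ { zero → ¬P₀ ; (suc q) → none q }
... | inj₂ none | yes P₀ =
  inj₁ (zero , P₀ , λ { zero _ → [ id , id ] (total P₀ P₀) ; (suc q) Pq → contradiction Pq (none q) })
... | inj₁ (p , Pp , p≼) | no ¬P₀ =
  inj₁ (suc p , Pp , λ { zero P₀ → contradiction P₀ ¬P₀ ; (suc q) → p≼ q })
... | inj₁ (p , Pp , p≼) | yes P₀ with total P₀ Pp
...   | inj₁ 0≼p =
  inj₁ (zero , P₀ , λ { zero _ → [ id , id ] (total P₀ P₀) ; (suc q) Pq → ≼-trans 0≼p (p≼ q Pq) })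
...   | inj₂ p≼0 = inj₁ (suc p , Pp , λ { zero _ → p≼0 ; (suc q) → p≼ q })

module _ {k : ℕ} where

  _[_]≔0 : (Fin k → ℕ) → Fin k → Fin k → ℕ
  (f [ a ]≔0) i = if does (i ≟ a) then 0 else f i

  []≔0-≢ : ∀ f {a i} → i ≢ a → (f [ a ]≔0) i ≡ f i
  []≔0-≢ f {a} {i} i≢a with i ≟ a
  ... | yes i≡a = contradiction i≡a i≢a
  ... | no _    = refl

sum-tabulate-[]≔0 : ∀ {k} (f : Fin k → ℕ) a → sum (tabulate f) ≡ f a + sum (tabulate (f [ a ]≔0))
sum-tabulate-[]≔0 f zero    = refl
sum-tabulate-[]≔0 f (suc a) rewrite sum-tabulate-[]≔0 (λ i → f (suc i)) a =
  x∙yz≈y∙xz (f zero) (f (suc a)) _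

sum-tabulate-0 : ∀ {k} (f : Fin k → ℕ) → (∀ i → f i ≡ 0) → sum (tabulate f) ≡ 0
sum-tabulate-0 {zero}  f f≡0 = refl
sum-tabulate-0 {suc k} f f≡0 rewrite f≡0 zero = sum-tabulate-0 (λ i → f (suc i)) (λ i → f≡0 (suc i))

sum-tabulate-≥ : ∀ {k} (f : Fin k → ℕ) a → f a ≤ sum (tabulate f)
sum-tabulate-≥ f a rewrite sum-tabulate-[]≔0 f a = m≤m+n (f a) _

sum-tabulate-≡1 : ∀ {k} (f : Fin k → ℕ) a → f a ≡ 1 → (∀ i → i ≢ a → f i ≡ 0) → sum (tabulate f) ≡ 1
sum-tabulate-≡1 f a fa≡1 f≡0 rewrite sum-tabulate-[]≔0 f a | fa≡1 =
  cong suc (sum-tabulate-0 (f [ a ]≔0) zero-elsewhere)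
  where
    zero-elsewhere : ∀ i → (f [ a ]≔0) i ≡ 0
    zero-elsewhere i with i ≟ a
    ... | yes _   = refl
    ... | no i≢a = f≡0 i i≢a

sum-tabulate-≥3 : ∀ {k} (f : Fin k → ℕ) {a b c} → a ≢ b → a ≢ c → b ≢ c →
  1 ≤ f a → 1 ≤ f b → 1 ≤ f c → 3 ≤ sum (tabulate f)
sum-tabulate-≥3 f {a} {b} {c} a≢b a≢c b≢c 1≤fa 1≤fb 1≤fc
  rewrite sum-tabulate-[]≔0 f a | sum-tabulate-[]≔0 (f [ a ]≔0) b =
  +-mono-≤ 1≤fa (+-mono-≤ 1≤f₁b (≤-trans 1≤f₂c (sum-tabulate-≥ _ c)))
  where
    1≤f₁b : 1 ≤ (f [ a ]≔0) b
    1≤f₁b rewrite []≔0-≢ f (λ b≡a → a≢b (sym b≡a)) = 1≤fb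
    1≤f₂c : 1 ≤ ((f [ a ]≔0) [ b ]≔0) c
    1≤f₂c rewrite []≔0-≢ (f [ a ]≔0) (λ c≡b → b≢c (sym c≡b)) | []≔0-≢ f (λ c≡a → a≢c (sym c≡a)) = 1≤fc

lookup-injective : ∀ {A : Set} {xs : List A} → AllPairs _≢_ xs →
  ∀ {i j} → lookup xs i ≡ lookup xs j → i ≡ j
lookup-injective (_ ∷ _)       {zero}  {zero}  _  = refl
lookup-injective (x≢ ∷ _)      {zero}  {suc j} eq = contradiction eq (All.lookup x≢ (∈-lookup j))
lookup-injective (x≢ ∷ _)      {suc i} {zero}  eq = contradiction (sym eq) (All.lookup x≢ (∈-lookup i))
lookup-injective (_ ∷ unique) {suc i} {suc j} eq = cong suc (lookup-injective unique eq)

⊆∧≢⇒⊂ : ∀ {n} {p q : 𝒫.Subset n} → p ⊆ q → p ≢ q → p ⊂ q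
⊆∧≢⇒⊂ {p = p} {q} p⊆q p≢q with any? (λ x → x ∈? q ×-dec ¬? (x ∈? p))
... | yes witness = p⊆q , witness
... | no  none    = contradiction (⊆-antisym p⊆q q⊆p) p≢q
  where
    q⊆p : q ⊆ p
    q⊆p {x} x∈q = decidable-stable (x ∈? p) (λ x∉p → none (x , x∈q , x∉p))

δ : ∀ {k} → Fin k → Fin k → ℕ
δ a b = if does (a ≟ b) then 1 else 0

δ-refl : ∀ {k} (a : Fin k) → δ a a ≡ 1
δ-refl a with a ≟ a
... | yes _   = refl
... | no a≢a = contradiction refl a≢a

δ-≢ : ∀ {k} {a b : Fin k} → a ≢ b → δ a b ≡ 0
δ-≢ {a = a} {b} a≢b with a ≟ b
... | yes a≡b = contradiction a≡b a≢b
... | no _    = refl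

degree≡sum-tabulate : ∀ {m k} (ends : Fin k → Fin m × Fin m) v →
  degree ends v ≡ sum (tabulate (λ e → δ v (proj₁ (ends e)) + δ v (proj₂ (ends e))))
degree≡sum-tabulate {k = k} ends v = cong sum (map-tabulate {n = k} id _)

∈-tabulate⇔ : ∀ {n} {f : Fin n → Bool} {x} → x ∈ Vec.tabulate f ⇔ f x ≡ true
∈-tabulate⇔ {f = f} {x} = mk⇔
  (λ x∈ → trans (sym (lookup∘tabulate f x)) ([]=⇒lookup x∈))
  (λ fx≡true → lookup⇒[]= x _ (trans (lookup∘tabulate f x) fx≡true))

xor≡true⇔ : ∀ a b → a xor b ≡ true ⇔ a ≡ not b
xor≡true⇔ true  b     = mk⇔ sym sym
xor≡true⇔ false true  = mk⇔ (λ _ → refl) (λ _ → refl)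
xor≡true⇔ false false = mk⇔ (λ ()) (λ ())

≡⊎≡not : ∀ a b → a ≡ b ⊎ a ≡ not b
≡⊎≡not a b with a Bool.≟ b
... | yes a≡b = inj₁ a≡b
... | no a≢b  = inj₂ (¬-not a≢b)

module _ {n : ℕ} where

  ≐-sym : {A B : Subset n} → A ≐ B → B ≐ A
  ≐-sym A≐B x = ⇔.sym (A≐B x)

  ≐-trans : {A B C : Subset n} → A ≐ B → B ≐ C → A ≐ C
  ≐-trans A≐B B≐C x = ⇔.trans (A≐B x) (B≐C x)

  BlocksAre-cong : ∀ {P : Partition n} {C C′ : Subset n → Set} →
    (∀ B → C B → C′ B) → (∀ B → C′ B → C B) → BlocksAre P C → BlocksAre P C′
  BlocksAre-cong C⇒C′ C′⇒C (blocks⇒C , C⇒blocks) =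
    (λ i → let (B , CB , iB) = blocks⇒C i in B , C⇒C′ B CB , iB) ,
    (λ B C′B → C⇒blocks B (C′⇒C B C′B))

≐ₛ-cong : ∀ {n} {σ : Split n} {L R L′ R′} → σ ≐ₛ L , R → L ≐ L′ → R ≐ R′ → σ ≐ₛ L′ , R′
≐ₛ-cong (inj₁ (A₁≐L , A₂≐R)) L≐ R≐ = inj₁ (≐-trans A₁≐L L≐ , ≐-trans A₂≐R R≐)
≐ₛ-cong (inj₂ (A₁≐R , A₂≐L)) L≐ R≐ = inj₂ (≐-trans A₁≐R R≐ , ≐-trans A₂≐L L≐)

module _ {m k : ℕ} {ends : Fin k → Fin m × Fin m} where

  Reach-mono : ∀ {A B : Fin k → Set} → (∀ e → A e → B e) →
               ∀ {u v} → Reach ends A u v → Reach ends B u v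
  Reach-mono A⇒B here            = here
  Reach-mono A⇒B (fwd e a eq ρ) = fwd e (A⇒B e a) eq (Reach-mono A⇒B ρ)
  Reach-mono A⇒B (bwd e a eq ρ) = bwd e (A⇒B e a) eq (Reach-mono A⇒B ρ)

  Reach-trans : ∀ {A u v w} → Reach ends A u v → Reach ends A v w → Reach ends A u w
  Reach-trans here           τ = τ
  Reach-trans (fwd e a eq ρ) τ = fwd e a eq (Reach-trans ρ τ)
  Reach-trans (bwd e a eq ρ) τ = bwd e a eq (Reach-trans ρ τ)

  Reach-sym : ∀ {A u v} → Reach ends A u v → Reach ends A v u
  Reach-sym here             = here
  Reach-sym (fwd e a refl ρ) = Reach-trans (Reach-sym ρ) (bwd e a refl here)
  Reach-sym (bwd e a refl ρ) = Reach-trans (Reach-sym ρ) (fwd e a refl here)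

  _∖_ : (Fin k → Set) → Fin k → Fin k → Set
  (A ∖ e) f = A f × f ≢ e

  Crosses : (Fin k → Set) → Fin k → Fin m → Fin m → Set
  Crosses A e u w =
    (Reach ends A u (proj₁ (ends e)) × Reach ends A (proj₂ (ends e)) w) ⊎
    (Reach ends A u (proj₂ (ends e)) × Reach ends A (proj₁ (ends e)) w)

  avoids-or-crosses : ∀ {A u w} e → Reach ends A u w →
                      Reach ends (A ∖ e) u w ⊎ Crosses (A ∖ e) e u w
  avoids-or-crosses e here = inj₁ here
  avoids-or-crosses e (fwd f a refl ρ) with f ≟ e | avoids-or-crosses e ρ
  ... | yes refl | inj₁ ρ′                = inj₂ (inj₁ (here , ρ′))
  ... | yes refl | inj₂ (inj₁ (_ , ρ₂))  = inj₂ (inj₁ (here , ρ₂))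
  ... | yes refl | inj₂ (inj₂ (_ , ρ₂))  = inj₁ ρ₂
  ... | no f≢e   | inj₁ ρ′                = inj₁ (fwd f (a , f≢e) refl ρ′)
  ... | no f≢e   | inj₂ (inj₁ (ρ₁ , ρ₂)) = inj₂ (inj₁ (fwd f (a , f≢e) refl ρ₁ , ρ₂))
  ... | no f≢e   | inj₂ (inj₂ (ρ₁ , ρ₂)) = inj₂ (inj₂ (fwd f (a , f≢e) refl ρ₁ , ρ₂))
  avoids-or-crosses e (bwd f a refl ρ) with f ≟ e | avoids-or-crosses e ρ
  ... | yes refl | inj₁ ρ′                = inj₂ (inj₂ (here , ρ′))
  ... | yes refl | inj₂ (inj₁ (_ , ρ₂))  = inj₁ ρ₂
  ... | yes refl | inj₂ (inj₂ (_ , ρ₂))  = inj₂ (inj₂ (here , ρ₂))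
  ... | no f≢e   | inj₁ ρ′                = inj₁ (bwd f (a , f≢e) refl ρ′)
  ... | no f≢e   | inj₂ (inj₁ (ρ₁ , ρ₂)) = inj₂ (inj₁ (bwd f (a , f≢e) refl ρ₁ , ρ₂))
  ... | no f≢e   | inj₂ (inj₂ (ρ₁ , ρ₂)) = inj₂ (inj₂ (bwd f (a , f≢e) refl ρ₁ , ρ₂))

  IsBridge : Fin k → Set
  IsBridge e = ¬ Reach ends (_≢ e) (proj₁ (ends e)) (proj₂ (ends e))

  bridge-uncrossed : ∀ {A e u w} → IsBridge e → Reach ends (_≢ e) u w → ¬ Crosses (A ∖ e) e u w
  bridge-uncrossed bridge ρ (inj₁ (ρ₁ , ρ₂)) =
    bridge (Reach-sym (Reach-trans (weaken ρ₂) (Reach-trans (Reach-sym ρ) (weaken ρ₁))))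
    where weaken = Reach-mono (λ _ → proj₂)
  bridge-uncrossed bridge ρ (inj₂ (ρ₁ , ρ₂)) =
    bridge (Reach-trans (weaken ρ₂) (Reach-trans (Reach-sym ρ) (weaken ρ₁)))
    where weaken = Reach-mono (λ _ → proj₂)

  module _ (forest : ∀ e → IsBridge e) (H : Fin k → Set) {u w : Fin m}
           (H-avoidable : ∀ e → H e → Reach ends (_≢ e) u w) where

    -- A walk crossing e shows e ∉ H: together with a walk avoiding e it would join the
    -- ends of the bridge e.
    avoid-one : ∀ {A} e → Reach ends A u w → Reach ends (λ f → A f × (f ≡ e → ¬ H e)) u w
    avoid-one e ρ with avoids-or-crosses e ρ
    ... | inj₁ ρ′ = Reach-mono (λ { f (a , f≢e) → a , λ f≡e → contradiction f≡e f≢e }) ρ′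
    ... | inj₂ c  =
      Reach-mono (λ f a → a , λ _ He → bridge-uncrossed (forest e) (H-avoidable e He) c) ρ

    avoid-list : (es : List (Fin k)) → Reach ends (λ _ → ⊤) u w →
                 Reach ends (λ f → f ∈ₗ es → ¬ H f) u w
    avoid-list []       ρ = Reach-mono (λ _ _ ()) ρ
    avoid-list (e ∷ es) ρ = Reach-mono step (avoid-one e (avoid-list es ρ))
      where
        step : ∀ f → (f ∈ₗ es → ¬ H f) × (f ≡ e → ¬ H e) → f ∈ₗ e ∷ es → ¬ H f
        step f (¬H , _) (there f∈es) = ¬H f∈es
        step f (_ , ¬H) (here refl)  = ¬H refl

    forest-avoid : Reach ends (λ _ → ⊤) u w → Reach ends (λ f → ¬ H f) u w
    forest-avoid ρ = Reach-mono (λ f ¬H → ¬H (∈-allFin f)) (avoid-list (allFin k) ρ)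

SameSide : ∀ {n} → Split n → Fin n → Fin n → Set
SameSide σ x y = (A₁ σ x → A₁ σ y) × (A₂ σ x → A₂ σ y)

module _ {n} (T : UTree n) (e : Fin (nE T)) (σ : Split n) where

  private
    Shore : Fin (nV T) → Subset n
    Shore = compLeaves T (_≡ e)

    sameSide⇔avoiding-from : ∀ {a b} → A₁ σ ≐ Shore a → A₂ σ ≐ Shore b → ∀ {x y} →
      SameSide σ x y ⇔ Reach (ends T) (_≢ e) (leaf T x) (leaf T y)
    sameSide⇔avoiding-from A₁≐ A₂≐ {x} {y} = mk⇔ same⇒reach reach⇒same
      where
        joined : ∀ {v} → Shore v x → Shore v y → Reach (ends T) (_≢ e) (leaf T x) (leaf T y)
        joined ρ ρ′ = Reach-trans (Reach-sym ρ) ρ′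
        same⇒reach : SameSide σ x y → Reach (ends T) (_≢ e) (leaf T x) (leaf T y)
        same⇒reach (A₁⇒ , A₂⇒) with cover σ x
        ... | inj₁ x∈A₁ = joined (to (A₁≐ x) x∈A₁) (to (A₁≐ y) (A₁⇒ x∈A₁))
        ... | inj₂ x∈A₂ = joined (to (A₂≐ x) x∈A₂) (to (A₂≐ y) (A₂⇒ x∈A₂))
        reach⇒same : Reach (ends T) (_≢ e) (leaf T x) (leaf T y) → SameSide σ x y
        reach⇒same ρ = (λ x∈A₁ → from (A₁≐ y) (Reach-trans (to (A₁≐ x) x∈A₁) ρ))
                     , (λ x∈A₂ → from (A₂≐ y) (Reach-trans (to (A₂≐ x) x∈A₂) ρ))

  edgeSplit-sameSide⇔ : IsEdgeSplit T e σ → ∀ {x y} →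
    SameSide σ x y ⇔ Reach (ends T) (_≢ e) (leaf T x) (leaf T y)
  edgeSplit-sameSide⇔ (inj₁ (A₁≐ , A₂≐)) = sameSide⇔avoiding-from A₁≐ A₂≐
  edgeSplit-sameSide⇔ (inj₂ (A₁≐ , A₂≐)) = sameSide⇔avoiding-from A₁≐ A₂≐

module _ {n} (𝔖 : SplitSystem n) (T : UTree n) where

  record Represents (𝔥 : SubSystem 𝔖) (H : Fin (nE T) → Set) : Set where
    field
      edge⇒split : ∀ e → H e → ∃ λ j → 𝔥 j × IsEdgeSplit T e (split 𝔖 j)
      split⇒edge : ∀ j → 𝔥 j → ∃ λ e → H e × IsEdgeSplit T e (split 𝔖 j)

  splitsOf : (Fin (nE T) → Set) → SubSystem 𝔖
  splitsOf H j = ∃ λ e → H e × IsEdgeSplit T e (split 𝔖 j)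

  edgesOf-represents : Displays T 𝔖 → ∀ 𝔥 → Represents 𝔥 (edgesOf T 𝔖 𝔥)
  edgesOf-represents (_ , split⇒edge) 𝔥 = record
    { edge⇒split = λ e → id
    ; split⇒edge = λ j 𝔥j → let (e , eσ) = split⇒edge j in e , (j , 𝔥j , eσ) , eσ
    }

  splitsOf-represents : Displays T 𝔖 → ∀ H → Represents (splitsOf H) H
  splitsOf-represents (edge⇒split , _) H = record
    { edge⇒split = λ e He → let (j , eσ) = edge⇒split e in j , (e , He , eσ) , eσ
    ; split⇒edge = λ j → id
    }

  crClass≐compLeaves : ∀ {𝔥 H} → Represents 𝔥 H → ∀ x → crClass 𝔖 𝔥 x ≐ compLeaves T H (leaf T x)
  crClass≐compLeaves {𝔥} {H} represents x y = mk⇔ class⇒comp comp⇒class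
    where
      open Represents represents
      class⇒comp : crClass 𝔖 𝔥 x y → compLeaves T H (leaf T x) y
      class⇒comp same = forest-avoid (bridge T) H
        (λ e He → let (j , 𝔥j , eσ) = edge⇒split e He in
                    to (edgeSplit-sameSide⇔ T e (split 𝔖 j) eσ) (same j 𝔥j))
        (connected T _ _)
      comp⇒class : compLeaves T H (leaf T x) y → crClass 𝔖 𝔥 x y
      comp⇒class ρ j 𝔥j = let (e , He , eσ) = split⇒edge j 𝔥j in
        from (edgeSplit-sameSide⇔ T e (split 𝔖 j) eσ) (Reach-mono (λ { f ¬Hf refl → ¬Hf He }) ρ)

module _ {n} (T : UTree n) (H : Fin (nE T) → Set) where

  compLeaves-recentre : ∀ {v x} → compLeaves T H v x → compLeaves T H v ≐ compLeaves T H (leaf T x)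
  compLeaves-recentre ρ y = mk⇔ (Reach-trans (Reach-sym ρ)) (Reach-trans ρ)

  leafClass⇔component : ∀ (K : Fin n → Subset n) → (∀ x → K x ≐ compLeaves T H (leaf T x)) →
    ∀ B → (∃ λ x → B ≐ K x) ⇔ (Nonempty B × ∃ λ v → B ≐ compLeaves T H v)
  leafClass⇔component K K≐ B = mk⇔
    (λ (x , B≐Kx) → let B≐ = ≐-trans B≐Kx (K≐ x) in (x , from (B≐ x) here) , leaf T x , B≐)
    (λ ((y , y∈B) , v , B≐) →
      y , ≐-trans B≐ (≐-trans (compLeaves-recentre (to (B≐ y) y∈B)) (≐-sym (K≐ y))))

  commonRefinement⇔forestPartition : ∀ {𝔖 𝔥} (P : Partition n) →
    (∀ x → crClass 𝔖 𝔥 x ≐ compLeaves T H (leaf T x)) →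
    IsCommonRefinement 𝔖 𝔥 P ⇔ IsForestPartition T H P
  commonRefinement⇔forestPartition {𝔖} {𝔥} P class≐ = mk⇔
    (BlocksAre-cong {P = P} (λ B → to (equiv B)) (λ B → from (equiv B)))
    (BlocksAre-cong {P = P} (λ B → from (equiv B)) (λ B → to (equiv B)))
    where equiv = leafClass⇔component (crClass 𝔖 𝔥) class≐

represents⇒refinement⇔forest : ∀ {n} {𝔖 : SplitSystem n} {T 𝔥 H} → Represents 𝔖 T 𝔥 H →
  ∀ P → IsCommonRefinement 𝔖 𝔥 P ⇔ IsForestPartition T H P
represents⇒refinement⇔forest {𝔖 = 𝔖} {T} {𝔥} {H} represents P =
  commonRefinement⇔forestPartition T H {𝔖} {𝔥} P (crClass≐compLeaves 𝔖 T represents)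

module _ {n} (σ : Split n) where

  Side : Bool → Subset n
  Side true  = A₁ σ
  Side false = A₂ σ

  A₁? : ∀ x → Dec (A₁ σ x)
  A₁? x with cover σ x
  ... | inj₁ x∈A₁ = yes x∈A₁
  ... | inj₂ x∈A₂ = no λ x∈A₁ → disj σ x x∈A₁ x∈A₂

  side : Fin n → Bool
  side x = does (A₁? x)

  side≡⇔ : ∀ x b → side x ≡ b ⇔ Side b x
  side≡⇔ x b with cover σ x
  side≡⇔ x true  | inj₁ x∈A₁ = mk⇔ (λ _ → x∈A₁) (λ _ → refl)
  side≡⇔ x false | inj₁ x∈A₁ = mk⇔ (λ ()) (λ x∈A₂ → ⊥-elim (disj σ x x∈A₁ x∈A₂))
  side≡⇔ x true  | inj₂ x∈A₂ = mk⇔ (λ ()) (λ x∈A₁ → ⊥-elim (disj σ x x∈A₁ x∈A₂))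
  side≡⇔ x false | inj₂ x∈A₂ = mk⇔ (λ _ → x∈A₂) (λ _ → refl)

  Side-side : ∀ x → Side (side x) x
  Side-side x = to (side≡⇔ x (side x)) refl

  Side-disjoint : ∀ b {x} → Side b x → ¬ Side (not b) x
  Side-disjoint b {x} x∈b x∈¬b = not-¬ (from (side≡⇔ x b) x∈b) (from (side≡⇔ x (not b)) x∈¬b)

  ¬Side⇒Side-not : ∀ b {x} → ¬ Side b x → Side (not b) x
  ¬Side⇒Side-not b {x} x∉b = to (side≡⇔ x (not b)) (¬-not (x∉b ∘ to (side≡⇔ x b)))

  Side-nonempty : ∀ b → Nonempty (Side b)
  Side-nonempty true  = ne₁ σ
  Side-nonempty false = ne₂ σ

  split-≐ₛ-Side : ∀ b → σ ≐ₛ Side (not b) , Side b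
  split-≐ₛ-Side true  = inj₂ ((λ _ → ⇔.refl) , (λ _ → ⇔.refl))
  split-≐ₛ-Side false = inj₁ ((λ _ → ⇔.refl) , (λ _ → ⇔.refl))

  -- The side of σ not containing r.
  cluster : Fin n → 𝒫.Subset n
  cluster r = Vec.tabulate (λ x → side x xor side r)

  ∈cluster⇔ : ∀ r x → x ∈ cluster r ⇔ Side (not (side r)) x
  ∈cluster⇔ r x = ⇔.trans ∈-tabulate⇔ (⇔.trans (xor≡true⇔ (side x) (side r)) (side≡⇔ x (not (side r))))

  module _ (r : Fin n) where

    r∉cluster : r ∉ cluster r
    r∉cluster r∈ = Side-disjoint (side r) (Side-side r) (to (∈cluster⇔ r r) r∈)

    cluster-nonempty : 𝒫.Nonempty (cluster r)
    cluster-nonempty = let (y , y∈) = Side-nonempty (not (side r)) in y , from (∈cluster⇔ r y) y∈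

    ∉cluster⇔ : ∀ x → x ∉ cluster r ⇔ Side (side r) x
    ∉cluster⇔ x = mk⇔
      (λ x∉ → subst (λ b → Side b x) (not-involutive (side r))
                 (¬Side⇒Side-not (not (side r)) (x∉ ∘ from (∈cluster⇔ r x))))
      (λ x∈r-side x∈ → Side-disjoint (side r) x∈r-side (to (∈cluster⇔ r x) x∈))

    split-≐ₛ-cluster : σ ≐ₛ (_∈ cluster r) , (_∉ cluster r)
    split-≐ₛ-cluster = ≐ₛ-cong {σ = σ} (split-≐ₛ-Side (side r))
      (λ x → ⇔.sym (∈cluster⇔ r x)) (λ x → ⇔.sym (∉cluster⇔ x))

    cluster-far-from : ∀ {b} → Side b r → ∀ x → x ∈ cluster r ⇔ Side (not b) x
    cluster-far-from {b} r∈b x =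
      subst (λ c → x ∈ cluster r ⇔ Side (not c) x) (from (side≡⇔ r b) r∈b) (∈cluster⇔ r x)

    cluster-≐ : ∀ {L R} → σ ≐ₛ L , R → R r → ∀ x → x ∈ cluster r ⇔ L x
    cluster-≐ (inj₁ (A₁≐L , A₂≐R)) r∈R x =
      ⇔.trans (cluster-far-from {false} (from (A₂≐R r) r∈R) x) (A₁≐L x)
    cluster-≐ (inj₂ (A₁≐R , A₂≐L)) r∈R x =
      ⇔.trans (cluster-far-from {true} (from (A₁≐R r) r∈R) x) (A₂≐L x)

CompatibleSplits : ∀ {n} → Split n → Split n → Set
CompatibleSplits σ τ =
  Empty (A₁ σ ∩ A₁ τ) ⊎ Empty (A₁ σ ∩ A₂ τ) ⊎ Empty (A₂ σ ∩ A₁ τ) ⊎ Empty (A₂ σ ∩ A₂ τ)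

module _ {n} (σ τ : Split n) where

  empty-quadrant : CompatibleSplits σ τ → ∃₂ λ a b → ∀ y → ¬ (Side σ a y × Side τ b y)
  empty-quadrant (inj₁ empty)               = true  , true  , empty
  empty-quadrant (inj₂ (inj₁ empty))        = true  , false , empty
  empty-quadrant (inj₂ (inj₂ (inj₁ empty))) = false , true  , empty
  empty-quadrant (inj₂ (inj₂ (inj₂ empty))) = false , false , empty

  nested-Sides : ∀ {u v r x} → Side σ u r → Side τ v r → Side σ (not u) x → Side τ (not v) x →
    ∀ {a b} → (∀ y → ¬ (Side σ a y × Side τ b y)) →
    (∀ {y} → Side σ (not u) y → Side τ (not v) y) ⊎ (∀ {y} → Side τ (not v) y → Side σ (not u) y)
  nested-Sides {u} {v} {r} {x} r∈u r∈v x∈u x∈v {a} {b} empty with ≡⊎≡not a u | ≡⊎≡not b v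
  ... | inj₁ refl | inj₁ refl = ⊥-elim (empty r (r∈u , r∈v))
  ... | inj₂ refl | inj₂ refl = ⊥-elim (empty x (x∈u , x∈v))
  ... | inj₂ refl | inj₁ refl = inj₁ λ y∈u → ¬Side⇒Side-not τ v (λ y∈v → empty _ (y∈u , y∈v))
  ... | inj₁ refl | inj₂ refl = inj₂ λ y∈v → ¬Side⇒Side-not σ u (λ y∈u → empty _ (y∈u , y∈v))

nested-clusters : ∀ {n} (σ τ : Split n) r {x} → CompatibleSplits σ τ →
  x ∈ cluster σ r → x ∈ cluster τ r → cluster σ r ⊆ cluster τ r ⊎ cluster τ r ⊆ cluster σ r
nested-clusters σ τ r {x} compat x∈σ x∈τ =
  let (a , b , empty) = empty-quadrant σ τ compat in
  Sum.map (λ σ⊆τ {y} y∈σ → from (∈cluster⇔ τ r y) (σ⊆τ (to (∈cluster⇔ σ r y) y∈σ)))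
          (λ τ⊆σ {y} y∈τ → from (∈cluster⇔ σ r y) (τ⊆σ (to (∈cluster⇔ τ r y) y∈τ)))
          (nested-Sides σ τ {side σ r} {side τ r} (Side-side σ r) (Side-side τ r)
                        (to (∈cluster⇔ σ r x) x∈σ) (to (∈cluster⇔ τ r x) x∈τ) {a} {b} empty)

module ClusterTree {n m : ℕ} (r : Fin n) (C : Fin m → 𝒫.Subset n)
  (C-injective : ∀ {i j} → C i ≡ C j → i ≡ j)
  (r∉C : ∀ i → r ∉ C i)
  (C-nonempty : ∀ i → 𝒫.Nonempty (C i))
  (C-nested : ∀ {i j x} → x ∈ C i → x ∈ C j → C i ⊆ C j ⊎ C j ⊆ C i)
  (C-singleton : ∀ x → x ≢ r → ∃ λ i → C i ≡ ⁅ x ⁆)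
  (C-full : ∃ λ i → ∀ {x} → x ≢ r → x ∈ C i)
  where

  -- Vertex zero is the leaf r and vertex suc i the cluster C i; edge i joins C i to its
  -- parent, the least cluster strictly containing it, or to r if there is none.

  ⊆∧≢⇒C⊂ : ∀ {i j} → C i ⊆ C j → i ≢ j → C i ⊂ C j
  ⊆∧≢⇒C⊂ i⊆j i≢j = ⊆∧≢⇒⊂ i⊆j (i≢j ∘ C-injective)

  ParentSpec : Fin m → Fin (suc m) → Set
  ParentSpec i zero    = ∀ q → ¬ C i ⊂ C q
  ParentSpec i (suc p) = C i ⊂ C p × (∀ q → C i ⊂ C q → C p ⊆ C q)

  above-nested : ∀ {i a b} → C i ⊂ C a → C i ⊂ C b → C a ⊆ C b ⊎ C b ⊆ C a
  above-nested {i} (i⊆a , _) (i⊆b , _) = let (x , x∈i) = C-nonempty i in C-nested (i⊆a x∈i) (i⊆b x∈i)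

  parent-exists : ∀ i → ∃ (ParentSpec i)
  parent-exists i with least {_≼_ = λ a b → C a ⊆ C b} (λ q → C i ⊂? C q) ⊆-trans above-nested
  ... | inj₁ (p , spec) = suc p , spec
  ... | inj₂ none       = zero , none

  parent : Fin m → Fin (suc m)
  parent i = proj₁ (parent-exists i)

  parent-spec : ∀ i → ParentSpec i (parent i)
  parent-spec i = proj₂ (parent-exists i)

  parent-⊂ : ∀ {i p} → parent i ≡ suc p → C i ⊂ C p
  parent-⊂ {i} eq with parent i | parent-spec i | eq
  ... | suc p | (i⊂p , _) | refl = i⊂p

  parent≢self : ∀ i → parent i ≢ suc i
  parent≢self i eq = ⊂-irref refl (parent-⊂ eq)

  top : Fin m
  top = proj₁ C-full

  C⊆top : ∀ i → C i ⊆ C top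
  C⊆top i x∈i = proj₂ C-full λ { refl → r∉C i x∈i }

  parent-top : parent top ≡ zero
  parent-top with parent top | parent-spec top
  ... | zero  | _                     = refl
  ... | suc p | ((_ , x , x∈p , x∉top) , _) = contradiction (C⊆top p x∈p) x∉top

  parent≡root⇒top : ∀ {i} → parent i ≡ zero → i ≡ top
  parent≡root⇒top {i} eq with parent i | parent-spec i | eq | i ≟ top
  ... | zero | none | refl | no i≢top = contradiction (⊆∧≢⇒C⊂ (C⊆top i) i≢top) (none top)
  ... | zero | none | refl | yes i≡top = i≡top

  endpoints : Fin m → Fin (suc m) × Fin (suc m)
  endpoints i = suc i , parent i

  Path : (Fin m → Set) → Fin (suc m) → Fin (suc m) → Set
  Path = Reach endpoints

  module _ (Q : Fin (suc m) → Set) (A : Fin m → Set) {t : Fin (suc m)}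
           (at-root : Q zero → Path A zero t)
           (step : ∀ j → Q (suc j) → suc j ≡ t ⊎ (A j × Q (parent j))) where

    via-parent : ∀ j → (∀ {p} → C j ⊂ C p → Q (suc p) → Path A (suc p) t) →
                 Q (parent j) → Path A (parent j) t
    via-parent j from-above q with parent j | parent-spec j
    ... | zero  | _         = at-root q
    ... | suc p | (j⊂p , _) = from-above j⊂p q

    ascend-from : ∀ j → Acc (_⊃_ on C) j → Q (suc j) → Path A (suc j) t
    ascend-from j (acc above) q with step j q
    ... | inj₁ j≡t      = subst (Path A (suc j)) j≡t here
    ... | inj₂ (a , q↑) = fwd j a refl (via-parent j (λ j⊂p → ascend-from _ (above j⊂p)) q↑)

    ascend : ∀ v → Q v → Path A v t
    ascend zero    = at-root
    ascend (suc j) = ascend-from j (On.wellFounded C ⊃-wellFounded j)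

  -- v lies in the subtree hanging from edge i.
  Below : Fin m → Fin (suc m) → Set
  Below i zero    = ⊥
  Below i (suc j) = C j ⊆ C i

  Below-parent⁺ : ∀ {i j} → j ≢ i → Below i (suc j) → Below i (parent j)
  Below-parent⁺ {i} {j} j≢i j⊆i with parent j | parent-spec j
  ... | zero  | none      = none i (⊆∧≢⇒C⊂ j⊆i j≢i)
  ... | suc p | (_ , p≤) = p≤ i (⊆∧≢⇒C⊂ j⊆i j≢i)

  Below-parent⁻ : ∀ {i j} → Below i (parent j) → Below i (suc j)
  Below-parent⁻ {i} {j} b with parent j | parent-spec j
  ... | zero  | _         = ⊥-elim b
  ... | suc p | (j⊂p , _) = ⊆-trans (proj₁ j⊂p) b

  Below-invariant : ∀ {i u v} → Path (_≢ i) u v → Below i u → Below i v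
  Below-invariant here               b = b
  Below-invariant (fwd j j≢i refl ρ) b = Below-invariant ρ (Below-parent⁺ j≢i b)
  Below-invariant (bwd j _   refl ρ) b = Below-invariant ρ (Below-parent⁻ b)

  ¬Below-parent : ∀ i → ¬ Below i (parent i)
  ¬Below-parent i with parent i | parent-spec i
  ... | zero  | _                        = id
  ... | suc p | ((_ , x , x∈p , x∉i) , _) = λ p⊆i → x∉i (p⊆i x∈p)

  edge-bridge : ∀ i → ¬ Path (_≢ i) (suc i) (parent i)
  edge-bridge i ρ = ¬Below-parent i (Below-invariant ρ ⊆-refl)

  connected-to-root : ∀ v → Path (λ _ → ⊤) v zero
  connected-to-root v = ascend (λ _ → ⊤) (λ _ → ⊤) (λ _ → here) (λ _ _ → inj₂ (tt , tt)) v tt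

  leafOf : Fin n → Fin (suc m)
  leafOf x with x ≟ r
  ... | yes _   = zero
  ... | no x≢r = suc (proj₁ (C-singleton x x≢r))

  data LeafAt (x : Fin n) : Fin (suc m) → Set where
    at-root : x ≡ r → LeafAt x zero
    at-node : ∀ {i} → C i ≡ ⁅ x ⁆ → LeafAt x (suc i)

  leafAt : ∀ x → LeafAt x (leafOf x)
  leafAt x with x ≟ r
  ... | yes x≡r = at-root x≡r
  ... | no x≢r  = at-node (proj₂ (C-singleton x x≢r))

  ∈-singleton : ∀ {i x y} → C i ≡ ⁅ x ⁆ → y ∈ C i → y ≡ x
  ∈-singleton {x = x} Ci≡⁅x⁆ y∈i = x∈⁅y⁆⇒x≡y x (subst (_ ∈_) Ci≡⁅x⁆ y∈i)

  singleton-∈ : ∀ {i x} → C i ≡ ⁅ x ⁆ → x ∈ C i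
  singleton-∈ {x = x} Ci≡⁅x⁆ = subst (x ∈_) (sym Ci≡⁅x⁆) (x∈⁅x⁆ x)

  leafOf-root : leafOf r ≡ zero
  leafOf-root with leafOf r | leafAt r
  ... | zero  | _               = refl
  ... | suc s | at-node Cs≡⁅r⁆ = contradiction (singleton-∈ Cs≡⁅r⁆) (r∉C s)

  leafOf-singleton : ∀ {i x} → C i ≡ ⁅ x ⁆ → leafOf x ≡ suc i
  leafOf-singleton {i} {x} Ci≡⁅x⁆ with leafOf x | leafAt x
  ... | zero  | at-root refl   = contradiction (singleton-∈ Ci≡⁅x⁆) (r∉C i)
  ... | suc s | at-node Cs≡⁅x⁆ = cong suc (C-injective (trans Cs≡⁅x⁆ (sym Ci≡⁅x⁆)))

  leafOf-injective : ∀ {x y} → leafOf x ≡ leafOf y → x ≡ y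
  leafOf-injective {x} {y} eq with leafOf x | leafAt x | leafOf y | leafAt y | eq
  ... | zero  | at-root x≡r   | zero | at-root y≡r   | refl = trans x≡r (sym y≡r)
  ... | suc s | at-node Cs≡⁅x⁆ | _    | at-node Cs≡⁅y⁆ | refl =
    ∈-singleton Cs≡⁅y⁆ (singleton-∈ Cs≡⁅x⁆)

  Below-leafOf⇒∈ : ∀ {i} x → Below i (leafOf x) → x ∈ C i
  Below-leafOf⇒∈ x b with leafOf x | leafAt x
  ... | suc s | at-node Cs≡⁅x⁆ = b (singleton-∈ Cs≡⁅x⁆)

  ∈⇒Below-leafOf : ∀ {i} x → x ∈ C i → Below i (leafOf x)
  ∈⇒Below-leafOf {i} x x∈i with leafOf x | leafAt x
  ... | zero  | at-root refl   = r∉C i x∈i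
  ... | suc s | at-node Cs≡⁅x⁆ = λ y∈s → subst (_∈ C i) (sym (∈-singleton Cs≡⁅x⁆ y∈s)) x∈i

  IsSingleton : Fin m → Set
  IsSingleton i = ∃ λ x → C i ≡ ⁅ x ⁆

  singleton? : ∀ i → Dec (IsSingleton i)
  singleton? i = any? (λ x → ≡-dec Bool._≟_ (C i) ⁅ x ⁆)

  leafOf⇔singleton : ∀ i → (∃ λ x → leafOf x ≡ suc i) ⇔ IsSingleton i
  leafOf⇔singleton i = mk⇔ leaf⇒singleton (λ (x , Ci≡⁅x⁆) → x , leafOf-singleton Ci≡⁅x⁆)
    where
      leaf⇒singleton : (∃ λ x → leafOf x ≡ suc i) → IsSingleton i
      leaf⇒singleton (x , eq) with leafOf x | leafAt x | eq
      ... | suc _ | at-node Ci≡⁅x⁆ | refl = x , Ci≡⁅x⁆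

  singleton-childless : ∀ {i e} → IsSingleton i → parent e ≢ suc i
  singleton-childless {e = e} (x , Ci≡⁅x⁆) e↑i =
    let (e⊆i , y , y∈i , y∉e) = parent-⊂ e↑i
        (z , z∈e)             = C-nonempty e
    in y∉e (subst (_∈ C e) (trans (∈-singleton Ci≡⁅x⁆ (e⊆i z∈e)) (sym (∈-singleton Ci≡⁅x⁆ y∈i))) z∈e)

  maximal⇒child : ∀ {i d x} → C d ⊂ C i → x ∈ C d →
    (∀ q → C q ⊂ C i × x ∈ C q → C q ⊆ C d) → parent d ≡ suc i
  maximal⇒child {i} {d} d⊂i x∈d d-max with parent d | parent-spec d
  ... | zero  | none               = contradiction d⊂i (none i)
  ... | suc p | ((d⊆p , y , y∈p , y∉d) , p≤) with p ≟ i
  ...   | yes p≡i = cong suc p≡i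
  ...   | no p≢i  = contradiction (d-max p (⊆∧≢⇒C⊂ (p≤ i d⊂i) p≢i , d⊆p x∈d) y∈p) y∉d

  child-containing : ∀ {i x} → ¬ IsSingleton i → x ∈ C i → ∃ λ d → x ∈ C d × parent d ≡ suc i
  child-containing {i} {x} ¬single x∈i
    with least {P = λ d → C d ⊂ C i × x ∈ C d} {_≼_ = λ a b → C b ⊆ C a}
               (λ d → (C d ⊂? C i) ×-dec (x ∈? C d))
               (λ a⊇b b⊇c → ⊆-trans b⊇c a⊇b)
               (λ (_ , x∈a) (_ , x∈b) → swap (C-nested x∈a x∈b))
  ... | inj₁ (d , (d⊂i , x∈d) , d-max) = d , x∈d , maximal⇒child d⊂i x∈d d-max
  ... | inj₂ none = contradiction (⊆∧≢⇒⊂ ⁅x⁆⊆i ⁅x⁆≢i , singleton-∈ Cs≡⁅x⁆) (none s)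
    where
      x≢r : x ≢ r
      x≢r refl = r∉C i x∈i
      s = proj₁ (C-singleton x x≢r)
      Cs≡⁅x⁆ = proj₂ (C-singleton x x≢r)
      ⁅x⁆⊆i : C s ⊆ C i
      ⁅x⁆⊆i y∈s = subst (_∈ C i) (sym (∈-singleton Cs≡⁅x⁆ y∈s)) x∈i
      ⁅x⁆≢i : C s ≢ C i
      ⁅x⁆≢i Cs≡Ci = ¬single (x , trans (sym Cs≡Ci) Cs≡⁅x⁆)

  incidence : Fin (suc m) → Fin m → ℕ
  incidence v e = δ v (suc e) + δ v (parent e)

  root-degree : degree endpoints zero ≡ 1
  root-degree = trans (degree≡sum-tabulate endpoints zero)
    (sum-tabulate-≡1 (incidence zero) top (cong (δ zero) parent-top)
      (λ e e≢top → δ-≢ (λ 0≡parent → e≢top (parent≡root⇒top (sym 0≡parent)))))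

  singleton-degree : ∀ {i} → IsSingleton i → degree endpoints (suc i) ≡ 1
  singleton-degree {i} single = trans (degree≡sum-tabulate endpoints (suc i))
    (sum-tabulate-≡1 (incidence (suc i)) i own-edge other-edge)
    where
      own-edge : incidence (suc i) i ≡ 1
      own-edge rewrite δ-refl (suc i) | δ-≢ (parent≢self i ∘ sym) = refl
      other-edge : ∀ e → e ≢ i → incidence (suc i) e ≡ 0
      other-edge e e≢i rewrite δ-≢ {a = suc i} {b = suc e} (e≢i ∘ sym ∘ suc-injective) =
        δ-≢ (singleton-childless {e = e} single ∘ sym)

  internal-degree : ∀ {i} → ¬ IsSingleton i → 3 ≤ degree endpoints (suc i)
  internal-degree {i} ¬single =
    let (x , x∈i)            = C-nonempty i
        (d₁ , x∈d₁ , d₁↑i)   = child-containing ¬single x∈i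
        (_ , w , w∈i , w∉d₁) = parent-⊂ d₁↑i
        (d₂ , w∈d₂ , d₂↑i)   = child-containing ¬single w∈i
    in subst (3 ≤_) (sym (degree≡sum-tabulate endpoints (suc i)))
         (sum-tabulate-≥3 (incidence (suc i)) (not-own d₁↑i) (not-own d₂↑i)
           (λ d₁≡d₂ → w∉d₁ (subst (λ d → w ∈ C d) (sym d₁≡d₂) w∈d₂))
           own-edge (child-edge d₁↑i) (child-edge d₂↑i))
    where
      not-own : ∀ {d} → parent d ≡ suc i → i ≢ d
      not-own d↑i refl = parent≢self i d↑i
      own-edge : 1 ≤ incidence (suc i) i
      own-edge rewrite δ-refl (suc i) = s≤s z≤n
      child-edge : ∀ {d} → parent d ≡ suc i → 1 ≤ incidence (suc i) d
      child-edge d↑i rewrite d↑i | δ-refl (suc i) = m≤n+m 1 _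

  degree≡1⇔leaf : ∀ v → (degree endpoints v ≡ 1) ⇔ (∃ λ x → leafOf x ≡ v)
  degree≡1⇔leaf zero    = mk⇔ (λ _ → r , leafOf-root) (λ _ → root-degree)
  degree≡1⇔leaf (suc i) with singleton? i
  ... | yes single = mk⇔ (λ _ → from (leafOf⇔singleton i) single) (λ _ → singleton-degree single)
  ... | no ¬single = mk⇔
    (λ deg≡1 → contradiction (subst (3 ≤_) deg≡1 (internal-degree ¬single)) λ { (s≤s ()) })
    (λ leaf → contradiction (to (leafOf⇔singleton i) leaf) ¬single)

  nonleaf-degree : ∀ v → ¬ (∃ λ x → leafOf x ≡ v) → 3 ≤ degree endpoints v
  nonleaf-degree zero    ¬leaf = contradiction (r , leafOf-root) ¬leaf
  nonleaf-degree (suc i) ¬leaf = internal-degree (¬leaf ∘ from (leafOf⇔singleton i))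

  tree : UTree n
  tree = record
    { nV        = suc m
    ; nE        = m
    ; ends      = endpoints
    ; connected = λ u v → Reach-trans (connected-to-root u) (Reach-sym (connected-to-root v))
    ; bridge    = edge-bridge
    ; leaf      = leafOf
    ; leaf-inj  = leafOf-injective
    ; leaves    = degree≡1⇔leaf
    ; internal  = nonleaf-degree
    }

  below-edge⇔ : ∀ i x → compLeaves tree (_≡ i) (suc i) x ⇔ x ∈ C i
  below-edge⇔ i x = mk⇔
    (λ ρ → Below-leafOf⇒∈ x (Below-invariant {i} {suc i} ρ ⊆-refl))
    (λ x∈i → Reach-sym (ascend (Below i) (_≢ i) ⊥-elim climb (leafOf x) (∈⇒Below-leafOf x x∈i)))
    where
      climb : ∀ j → Below i (suc j) → suc j ≡ suc i ⊎ (j ≢ i × Below i (parent j))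
      climb j j⊆i with j ≟ i
      ... | yes j≡i = inj₁ (cong suc j≡i)
      ... | no j≢i  = inj₂ (j≢i , Below-parent⁺ j≢i j⊆i)

  above-edge⇔ : ∀ i x → compLeaves tree (_≡ i) (parent i) x ⇔ x ∉ C i
  above-edge⇔ i x = mk⇔
    (λ ρ x∈i → ¬Below-parent i (Below-invariant (Reach-sym ρ) (∈⇒Below-leafOf x x∈i)))
    (λ x∉i → Reach-trans (to-root (¬Below-parent i)) (Reach-sym (to-root (x∉i ∘ Below-leafOf⇒∈ x))))
    where
      climb : ∀ j → ¬ Below i (suc j) → suc j ≡ zero ⊎ (j ≢ i × ¬ Below i (parent j))
      climb j ¬j⊆i = inj₂ ((λ { refl → ¬j⊆i ⊆-refl }) , ¬j⊆i ∘ Below-parent⁻)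
      to-root : ∀ {v} → ¬ Below i v → Path (_≢ i) v zero
      to-root = ascend (λ v → ¬ Below i v) (_≢ i) (λ _ → here) climb _

module _ {n} (r : Fin n) (𝔖 : SplitSystem n) (treeLike : TreeLike 𝔖) where

  private
    splitCluster : Fin (card 𝔖) → 𝒫.Subset n
    splitCluster j = cluster (split 𝔖 j) r

    _≟ₛ_ : (p q : 𝒫.Subset n) → Dec (p ≡ q)
    _≟ₛ_ = ≡-dec Bool._≟_

    clusters : List (𝒫.Subset n)
    clusters = deduplicate _≟ₛ_ (map splitCluster (allFin (card 𝔖)))

    C : Fin (length clusters) → 𝒫.Subset n
    C = lookup clusters

    C-of-split : ∀ i → ∃ λ j → C i ≡ splitCluster j
    C-of-split i =
      let (j , _ , eq) = ∈-map⁻ splitCluster (∈-deduplicate⁻ _≟ₛ_ _ (∈-lookup {xs = clusters} i))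
      in j , eq

    split-in-C : ∀ j → ∃ λ i → C i ≡ splitCluster j
    split-in-C j = index listed , sym (lookup-index listed)
      where listed = ∈-deduplicate⁺ _≟ₛ_ (∈-map⁺ splitCluster (∈-allFin j))

    C-singleton : ∀ x → x ≢ r → ∃ λ i → C i ≡ ⁅ x ⁆
    C-singleton x x≢r =
      let (j , trivial) = proj₁ treeLike x
          (i , Ci≡)     = split-in-C j
          y∈⇔           = cluster-≐ (split 𝔖 j) r trivial (x≢r ∘ sym)
      in i , trans Ci≡ (⊆-antisym (λ {y} y∈ → subst (_∈ ⁅ x ⁆) (sym (to (y∈⇔ y) y∈)) (x∈⁅x⁆ x))
                                  (λ {y} y∈⁅x⁆ → from (y∈⇔ y) (x∈⁅y⁆⇒x≡y x y∈⁅x⁆)))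

    C-full : ∃ λ i → ∀ {x} → x ≢ r → x ∈ C i
    C-full =
      let (j , trivial) = proj₁ treeLike r
          (i , Ci≡)     = split-in-C j
      in i , λ {x} x≢r →
        subst (x ∈_) (sym Ci≡) (from (cluster-≐ (split 𝔖 j) r (swap trivial) refl x) x≢r)

    C-nested : ∀ {i j x} → x ∈ C i → x ∈ C j → C i ⊆ C j ⊎ C j ⊆ C i
    C-nested {i} {j} x∈i x∈j
      with C i | C j | C-of-split i | C-of-split j
    ... | _ | _ | (k , refl) | (l , refl) =
      nested-clusters (split 𝔖 k) (split 𝔖 l) r (proj₂ treeLike k l) x∈i x∈j

    C-injective : ∀ {i j} → C i ≡ C j → i ≡ j
    C-injective = lookup-injective (deduplicate-! _≟ₛ_ (map splitCluster (allFin (card 𝔖))))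

    r∉C : ∀ i → r ∉ C i
    r∉C i with C i | C-of-split i
    ... | _ | (j , refl) = r∉cluster (split 𝔖 j) r

    C-nonempty : ∀ i → 𝒫.Nonempty (C i)
    C-nonempty i with C i | C-of-split i
    ... | _ | (j , refl) = cluster-nonempty (split 𝔖 j) r

    open ClusterTree r C C-injective r∉C C-nonempty C-nested C-singleton C-full

    edge-split : ∀ {i j} → C i ≡ splitCluster j → IsEdgeSplit tree i (split 𝔖 j)
    edge-split {i} {j} Ci≡ = ≐ₛ-cong {σ = split 𝔖 j} (split-≐ₛ-cluster (split 𝔖 j) r)
      (λ x → ⇔.trans (∈⇔ x) (⇔.sym (below-edge⇔ i x)))
      (λ x → ⇔.trans (mk⇔ (λ x∉ → x∉ ∘ from (∈⇔ x)) (λ x∉ → x∉ ∘ to (∈⇔ x))) (⇔.sym (above-edge⇔ i x)))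
      where
        ∈⇔ : ∀ x → x ∈ splitCluster j ⇔ x ∈ C i
        ∈⇔ x = mk⇔ (subst (x ∈_) (sym Ci≡)) (subst (x ∈_) Ci≡)

  displayingTree : ∃ λ T → Displays T 𝔖
  displayingTree = tree ,
    (λ i → let (j , Ci≡) = C-of-split i in j , edge-split Ci≡) ,
    (λ j → let (i , Ci≡) = split-in-C j in i , edge-split Ci≡)

-- 3 ≤ n only provides the leaf at which the displaying tree is rooted.
theorem6p4 : (n : ℕ) → 3 ≤ n → (P : Partition n) → (𝔖 : SplitSystem n) → TreeLike 𝔖 →
    (Compatible P 𝔖 ⇔ (∃ λ (𝔥 : SubSystem 𝔖) → IsCommonRefinement 𝔖 𝔥 P)) ×
    ((𝔥 : SubSystem 𝔖) → IsCommonRefinement 𝔖 𝔥 P →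
      (T : UTree n) → Displays T 𝔖 → IsForestPartition T (edgesOf T 𝔖 𝔥) P)
theorem6p4 (suc n) (s≤s _) P 𝔖 treeLike =
  mk⇔ compatible⇒refinement refinement⇒compatible , refinement⇒forest
  where
    refinement⇒forest : ∀ 𝔥 → IsCommonRefinement 𝔖 𝔥 P →
      ∀ T → Displays T 𝔖 → IsForestPartition T (edgesOf T 𝔖 𝔥) P
    refinement⇒forest 𝔥 refines T displays =
      to (represents⇒refinement⇔forest (edgesOf-represents 𝔖 T displays 𝔥) P) refines

    compatible⇒refinement : Compatible P 𝔖 → ∃ λ 𝔥 → IsCommonRefinement 𝔖 𝔥 P
    compatible⇒refinement (T , displays , H , forest) =
      splitsOf 𝔖 T H , from (represents⇒refinement⇔forest (splitsOf-represents 𝔖 T displays H) P) forest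

    refinement⇒compatible : (∃ λ 𝔥 → IsCommonRefinement 𝔖 𝔥 P) → Compatible P 𝔖
    refinement⇒compatible (𝔥 , refines) =
      let (T , displays) = displayingTree zero 𝔖 treeLike in
      T , displays , edgesOf T 𝔖 𝔥 , refinement⇒forest 𝔥 refines T displays
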